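{- A finite hypergraph $\mathcal H=(V,E)$ is quasi-projective if and only if, for every positive integer $k$, whenever $E$ contains an edge with $k$ vertices, every nonempty subset of $V$ with at most $k$ elements belongs to $E$.
   Context: A hypergraph is a pair $\mathcal H=(V,E)$ with $E\subseteq\mathcal P(V)\setminus\{\emptyset\}$. A homomorphism $f:(V_1,E_1)\to(V_2,E_2)$ is a map $f:V_1\to V_2$ such that $f(e)=\{f(v):v\in e\}\in E_2$ for every $e\in E_1$; an epimorphism is a surjective homomorphism. A hypergraph $\mathcal S$ is quasi-projective if for every hypergraph $\mathcal T$, every homomorphism $f:\mathcal S\to\mathcal T$ and every epimorphism $j:\mathcal S\to\mathcal T$, there is an endomorphism $\phi$ of $\mathcal S$ with $j\circ\phi=f$. -}

module Defs where

open import Data.Nat using (ℕ; _≤_; _<_)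
open import Data.Fin using (Fin)
open import Data.Fin.Subset using (Subset; _∈_; ∣_∣; Nonempty)
open import Data.Product using (Σ; ∃; _×_; _,_)
open import Relation.Binary.PropositionalEquality using (_≡_)
open import Function.Bundles using (_⇔_; mk⇔; Equivalence)

_≐_ : {V : Set} → (V → Set) → (V → Set) → Set
P ≐ Q = ∀ v → P v ⇔ Q v

-- A general (possibly infinite) hypergraph: E is a set of nonempty subsets of V.
-- Since subsets are predicates, membership in E is required to respect
-- extensional equality of subsets.
record Hypergraph : Set₁ where
  field
    V        : Set
    E        : (V → Set) → Set
    E-resp   : ∀ {P Q} → P ≐ Q → E P → E Q
    E-nonempty : ∀ {P} → E P → ∃ λ v → P v

open Hypergraph public

image : {A B : Set} → (A → B) → (A → Set) → (B → Set)
image f P w = ∃ λ a → P a × f a ≡ w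

IsHom : (H₁ H₂ : Hypergraph) → (V H₁ → V H₂) → Set₁
IsHom H₁ H₂ f = ∀ (P : V H₁ → Set) → E H₁ P → E H₂ (image f P)

Surjective : {A B : Set} → (A → B) → Set
Surjective {A} {B} f = ∀ (b : B) → ∃ λ a → f a ≡ b

IsEpi : (H₁ H₂ : Hypergraph) → (V H₁ → V H₂) → Set₁
IsEpi H₁ H₂ f = IsHom H₁ H₂ f × Surjective f

QuasiProjective : Hypergraph → Set₁
QuasiProjective S =
  (T : Hypergraph) (f : V S → V T) (j : V S → V T) →
  IsHom S T f → IsEpi S T j →
  Σ (V S → V S) λ φ → IsHom S S φ × (∀ v → j (φ v) ≡ f v)

record FinHypergraph (n : ℕ) : Set₁ where
  field
    Edge          : Subset n → Set
    Edge-nonempty : ∀ {s} → Edge s → Nonempty s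

open FinHypergraph public

toHypergraph : ∀ {n} → FinHypergraph n → Hypergraph
toHypergraph {n} H = record
  { V = Fin n
  ; E = λ P → Σ (Subset n) λ s → Edge H s × (∀ i → P i ⇔ (i ∈ s))
  ; E-resp = λ { {P} {Q} P≐Q (s , e , eq) →
      s , e , (λ i → mk⇔
        (λ q → Equivalence.to (eq i) (Equivalence.from (P≐Q i) q))
        (λ m → Equivalence.to (P≐Q i) (Equivalence.from (eq i) m))) }
  ; E-nonempty = λ { {P} (s , e , eq) → ne P s e eq }
  }
  where
  ne : ∀ (P : Fin n → Set) s → Edge H s → (∀ i → P i ⇔ (i ∈ s)) → ∃ λ v → P v
  ne P s e eq with Edge-nonempty H e
  ... | i , i∈s = i , Equivalence.from (eq i) i∈s

DownClosed : ∀ {n} → FinHypergraph n → Set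
DownClosed {n} H =
  ∀ (k : ℕ) → 0 < k → (∃ λ s → Edge H s × ∣ s ∣ ≡ k) →
  ∀ (t : Subset n) → Nonempty t → ∣ t ∣ ≤ k → Edge H t

{-# OPTIONS --safe #-}
-- Quasi-projectivity says exactly that every self-map of the vertex set is an
-- endomorphism: take T to be the complete hypergraph (all nonempty subsets),
-- on which every map is a homomorphism, and j = id; conversely, if every map
-- is an endomorphism, φ can be any section of j composed with f. For a finite
-- hypergraph, "every self-map sends edges to edges" is the downward closure
-- condition: an image of an edge is nonempty and no larger than the edge, and
-- conversely any edge with k vertices can be mapped onto any nonempty set
-- with at most k vertices.
module Submission where

open import Defs
open import Data.Nat using (ℕ; zero; suc; _+_; _≤_; _<_; z≤n; s≤s)
open import Data.Nat.Properties using (+-suc; m≤n⇒m≤1+n; module ≤-Reasoning)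
open import Data.Product using (_×_; ∃; _,_; proj₁; proj₂)
open import Data.Sum using (_⊎_; inj₁; inj₂)
open import Data.Fin using (Fin; zero; suc)
open import Data.Fin.Properties using (suc-injective) renaming (_≟_ to _≟ᶠ_)
open import Data.Fin.Subset
  using (Subset; inside; outside; ∣_∣; Nonempty; ⊥; ⁅_⁆; _∪_; _∈_)
open import Data.Fin.Subset.Properties
  using (∉⊥; ⊆-antisym; x∈⁅x⁆; x∈⁅y⁆⇒x≡y; x∈p∪q⁺; x∈p∪q⁻; ∣⁅x⁆∣≡1; ∣⊥∣≡0)
open import Data.Vec using ([]; _∷_; here; there)
open import Data.List using (List; map; length) renaming ([] to []ₗ; _∷_ to _∷ₗ_)
open import Data.List.Properties using (length-map)
open import Data.List.Membership.Propositional using () renaming (_∈_ to _∈ₗ_)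
open import Data.List.Membership.Propositional.Properties using (∈-map⁺; ∈-map⁻)
open import Data.List.Relation.Unary.Any using () renaming (here to hereₗ; there to thereₗ)
import Data.List.Relation.Unary.All as All
import Data.List.Relation.Unary.All.Properties as All
open import Data.List.Relation.Unary.AllPairs using () renaming ([] to []ᵤ; _∷_ to _∷ᵤ_)
open import Data.List.Relation.Unary.Unique.Propositional using (Unique)
import Data.List.Relation.Unary.Unique.Propositional.Properties as Unique
open import Relation.Binary.Definitions using (DecidableEquality)
open import Relation.Binary.PropositionalEquality
  using (_≡_; _≢_; _≗_; refl; sym; trans; cong; subst; subst₂)
open import Relation.Nullary using (yes; no)
open import Data.Empty using (⊥-elim)
open import Function using (_∘_; id)
open import Function.Bundles using (_⇔_; mk⇔; Equivalence)
open import Function.Properties.Equivalence using () renaming (sym to ⇔-sym; trans to ⇔-trans)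

open Equivalence using (to; from)

private
  variable
    n m : ℕ

∣p∪q∣≤∣p∣+∣q∣ : ∀ (p q : Subset n) → ∣ p ∪ q ∣ ≤ ∣ p ∣ + ∣ q ∣
∣p∪q∣≤∣p∣+∣q∣ []            []            = z≤n
∣p∪q∣≤∣p∣+∣q∣ (outside ∷ p) (outside ∷ q) = ∣p∪q∣≤∣p∣+∣q∣ p q
∣p∪q∣≤∣p∣+∣q∣ (inside  ∷ p) (outside ∷ q) = s≤s (∣p∪q∣≤∣p∣+∣q∣ p q)
∣p∪q∣≤∣p∣+∣q∣ (outside ∷ p) (inside  ∷ q) =
  subst (suc ∣ p ∪ q ∣ ≤_) (sym (+-suc ∣ p ∣ ∣ q ∣)) (s≤s (∣p∪q∣≤∣p∣+∣q∣ p q))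
∣p∪q∣≤∣p∣+∣q∣ (inside  ∷ p) (inside  ∷ q) =
  s≤s (subst (∣ p ∪ q ∣ ≤_) (sym (+-suc ∣ p ∣ ∣ q ∣)) (m≤n⇒m≤1+n (∣p∪q∣≤∣p∣+∣q∣ p q)))

x∈p⇒0<∣p∣ : ∀ {x : Fin n} {p} → x ∈ p → 0 < ∣ p ∣
x∈p⇒0<∣p∣ {p = inside  ∷ p} _         = s≤s z≤n
x∈p⇒0<∣p∣ {p = outside ∷ p} (there x∈p) = x∈p⇒0<∣p∣ x∈p

imageˢ : (Fin n → Fin m) → Subset n → Subset m
imageˢ φ []            = ⊥
imageˢ φ (inside  ∷ s) = ⁅ φ zero ⁆ ∪ imageˢ (φ ∘ suc) s
imageˢ φ (outside ∷ s) = imageˢ (φ ∘ suc) s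

∈-imageˢ⁺ : ∀ (φ : Fin n → Fin m) s {w} → image φ (_∈ s) w → w ∈ imageˢ φ s
∈-imageˢ⁺ φ (inside ∷ s)  (zero  , here    , refl) = x∈p∪q⁺ (inj₁ (x∈⁅x⁆ (φ zero)))
∈-imageˢ⁺ φ (inside ∷ s)  (suc i , there h , eq)   = x∈p∪q⁺ (inj₂ (∈-imageˢ⁺ (φ ∘ suc) s (i , h , eq)))
∈-imageˢ⁺ φ (outside ∷ s) (suc i , there h , eq)   = ∈-imageˢ⁺ (φ ∘ suc) s (i , h , eq)

∈-imageˢ⁻ : ∀ (φ : Fin n → Fin m) s {w} → w ∈ imageˢ φ s → image φ (_∈ s) w
∈-imageˢ⁻ φ [] w∈⊥ = ⊥-elim (∉⊥ w∈⊥)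
∈-imageˢ⁻ φ (inside ∷ s) w∈ with x∈p∪q⁻ ⁅ φ zero ⁆ _ w∈
... | inj₁ w∈⁅φ0⁆ = zero , here , sym (x∈⁅y⁆⇒x≡y (φ zero) w∈⁅φ0⁆)
... | inj₂ w∈rest with ∈-imageˢ⁻ (φ ∘ suc) s w∈rest
...   | i , i∈s , eq = suc i , there i∈s , eq
∈-imageˢ⁻ φ (outside ∷ s) w∈ with ∈-imageˢ⁻ (φ ∘ suc) s w∈
... | i , i∈s , eq = suc i , there i∈s , eq

∈-imageˢ : ∀ (φ : Fin n → Fin m) s {w} → w ∈ imageˢ φ s ⇔ image φ (_∈ s) w
∈-imageˢ φ s = mk⇔ (∈-imageˢ⁻ φ s) (∈-imageˢ⁺ φ s)

∣imageˢ∣≤∣s∣ : ∀ (φ : Fin n → Fin m) s → ∣ imageˢ φ s ∣ ≤ ∣ s ∣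
∣imageˢ∣≤∣s∣ {m = m} φ [] = subst (_≤ 0) (sym (∣⊥∣≡0 m)) z≤n
∣imageˢ∣≤∣s∣ φ (inside ∷ s) = begin
  ∣ ⁅ φ zero ⁆ ∪ imageˢ (φ ∘ suc) s ∣      ≤⟨ ∣p∪q∣≤∣p∣+∣q∣ ⁅ φ zero ⁆ _ ⟩
  ∣ ⁅ φ zero ⁆ ∣ + ∣ imageˢ (φ ∘ suc) s ∣  ≡⟨ cong (_+ ∣ imageˢ (φ ∘ suc) s ∣) (∣⁅x⁆∣≡1 (φ zero)) ⟩
  suc ∣ imageˢ (φ ∘ suc) s ∣               ≤⟨ s≤s (∣imageˢ∣≤∣s∣ (φ ∘ suc) s) ⟩
  suc ∣ s ∣                                ∎
  where open ≤-Reasoning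
∣imageˢ∣≤∣s∣ φ (outside ∷ s) = ∣imageˢ∣≤∣s∣ (φ ∘ suc) s

imageˢ-unique : ∀ (φ : Fin n → Fin m) s t → (∀ w → w ∈ t ⇔ image φ (_∈ s) w) → imageˢ φ s ≡ t
imageˢ-unique φ s t t≐ =
  ⊆-antisym (λ {w} → from (t≐ w) ∘ ∈-imageˢ⁻ φ s) (λ {w} → ∈-imageˢ⁺ φ s ∘ to (t≐ w))

elements : Subset n → List (Fin n)
elements []            = []ₗ
elements (inside  ∷ s) = zero ∷ₗ map suc (elements s)
elements (outside ∷ s) = map suc (elements s)

∈-elements⁺ : ∀ {i : Fin n} {s} → i ∈ s → i ∈ₗ elements s
∈-elements⁺ {i = zero}  {inside  ∷ s} here        = hereₗ refl
∈-elements⁺ {i = suc i} {inside  ∷ s} (there i∈s) = thereₗ (∈-map⁺ suc (∈-elements⁺ i∈s))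
∈-elements⁺ {i = suc i} {outside ∷ s} (there i∈s) = ∈-map⁺ suc (∈-elements⁺ i∈s)

∈-elements⁻ : ∀ {i : Fin n} s → i ∈ₗ elements s → i ∈ s
∈-elements⁻ (inside ∷ s) (hereₗ refl) = here
∈-elements⁻ (inside ∷ s) (thereₗ i∈) with ∈-map⁻ suc i∈
... | j , j∈ , refl = there (∈-elements⁻ s j∈)
∈-elements⁻ (outside ∷ s) i∈ with ∈-map⁻ suc i∈
... | j , j∈ , refl = there (∈-elements⁻ s j∈)

length-elements : ∀ (s : Subset n) → length (elements s) ≡ ∣ s ∣
length-elements []            = refl
length-elements (inside  ∷ s) = cong suc (trans (length-map suc (elements s)) (length-elements s))
length-elements (outside ∷ s) = trans (length-map suc (elements s)) (length-elements s)

elements-unique : ∀ (s : Subset n) → Unique (elements s)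
elements-unique []            = []ᵤ
elements-unique (inside  ∷ s) =
  All.map⁺ (All.tabulate λ _ ()) ∷ᵤ Unique.map⁺ suc-injective (elements-unique s)
elements-unique (outside ∷ s) = Unique.map⁺ suc-injective (elements-unique s)

module Pairing {A B : Set} (_≟_ : DecidableEquality A) (default : B) where

  pair : List A → List B → A → B
  pair (x ∷ₗ xs) (y ∷ₗ ys) a with a ≟ x
  ... | yes _ = y
  ... | no  _ = pair xs ys a
  pair _ _ _ = default

  pair-range : ∀ xs ys a → pair xs ys a ≡ default ⊎ pair xs ys a ∈ₗ ys
  pair-range []ₗ        _          a = inj₁ refl
  pair-range (x ∷ₗ xs)  []ₗ        a = inj₁ refl
  pair-range (x ∷ₗ xs) (y ∷ₗ ys) a with a ≟ x
  ... | yes _ = inj₂ (hereₗ refl)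
  ... | no  _ with pair-range xs ys a
  ...   | inj₁ eq = inj₁ eq
  ...   | inj₂ a∈ = inj₂ (thereₗ a∈)

  pair-head : ∀ x xs y ys → pair (x ∷ₗ xs) (y ∷ₗ ys) x ≡ y
  pair-head x xs y ys with x ≟ x
  ... | yes _   = refl
  ... | no  x≢x = ⊥-elim (x≢x refl)

  pair-tail : ∀ x xs y ys {a} → a ≢ x → pair (x ∷ₗ xs) (y ∷ₗ ys) a ≡ pair xs ys a
  pair-tail x xs y ys {a} a≢x with a ≟ x
  ... | yes a≡x = ⊥-elim (a≢x a≡x)
  ... | no  _   = refl

  pair-onto : ∀ {xs ys} → Unique xs → length ys ≤ length xs →
              ∀ {y} → y ∈ₗ ys → ∃ λ x → x ∈ₗ xs × pair xs ys x ≡ y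
  pair-onto {x ∷ₗ xs} {y ∷ₗ ys} _ _ (hereₗ refl) = x , hereₗ refl , pair-head x xs y ys
  pair-onto {x ∷ₗ xs} {y ∷ₗ ys} (x≢xs ∷ᵤ u) (s≤s l) (thereₗ y∈) with pair-onto u l y∈
  ... | x′ , x′∈ , eq =
    x′ , thereₗ x′∈ , trans (pair-tail x xs y ys (λ { refl → All.lookup x≢xs x′∈ refl })) eq

-- A map sending the i-th element of s to the i-th element of t and
-- everything else to a fixed element of t.
map-onto : ∀ (s : Subset n) (t : Subset m) → Nonempty t → ∣ t ∣ ≤ ∣ s ∣ →
       ∃ λ (g : Fin n → Fin m) → imageˢ g s ≡ t
map-onto s t (d , d∈t) ∣t∣≤∣s∣ = g , imageˢ-unique g s t λ w → mk⇔ (hit w) (range w)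
  where
  open Pairing _≟ᶠ_ d
  g = pair (elements s) (elements t)

  hit : ∀ w → w ∈ t → image g (_∈ s) w
  hit w w∈t with pair-onto (elements-unique s) length-bound (∈-elements⁺ w∈t)
    where
    length-bound : length (elements t) ≤ length (elements s)
    length-bound = subst₂ _≤_ (sym (length-elements t)) (sym (length-elements s)) ∣t∣≤∣s∣
  ... | x , x∈ , eq = x , ∈-elements⁻ s x∈ , eq

  range : ∀ w → image g (_∈ s) w → w ∈ t
  range w (i , _ , refl) with pair-range (elements s) (elements t) i
  ... | inj₁ eq = subst (_∈ t) (sym eq) d∈t
  ... | inj₂ ∈t = ∈-elements⁻ t ∈t

complete : Set → Hypergraph
complete A = record
  { V          = A
  ; E          = λ P → ∃ P
  ; E-resp     = λ { P≐Q (v , Pv) → v , to (P≐Q v) Pv }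
  ; E-nonempty = id
  }

isHom-complete : ∀ (H : Hypergraph) {A} (f : V H → A) → IsHom H (complete A) f
isHom-complete H f P e with E-nonempty H e
... | v , Pv = f v , v , Pv , refl

image-resp-≗ : ∀ {A B : Set} {f g : A → B} (P : A → Set) → f ≗ g → image f P ≐ image g P
image-resp-≗ P f≗g w =
  mk⇔ (λ { (a , Pa , eq) → a , Pa , trans (sym (f≗g a)) eq })
      (λ { (a , Pa , eq) → a , Pa , trans (f≗g a) eq })

image-resp-≐ : ∀ {A B : Set} (f : A → B) {P Q : A → Set} → P ≐ Q → image f P ≐ image f Q
image-resp-≐ f P≐Q w =
  mk⇔ (λ { (a , Pa , eq) → a , to (P≐Q a) Pa , eq })
      (λ { (a , Qa , eq) → a , from (P≐Q a) Qa , eq })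

isHom-resp-≗ : ∀ H₁ H₂ {f g : V H₁ → V H₂} → f ≗ g → IsHom H₁ H₂ f → IsHom H₁ H₂ g
isHom-resp-≗ H₁ H₂ f≗g hom P e = E-resp H₂ (image-resp-≗ P f≗g) (hom P e)

quasiProjective⇒isHom : ∀ S → QuasiProjective S → ∀ g → IsHom S S g
quasiProjective⇒isHom S qp g with qp (complete (V S)) g id (isHom-complete S g)
                                     (isHom-complete S id , λ v → v , refl)
... | φ , φ-hom , φ≗g = isHom-resp-≗ S S φ≗g φ-hom

isHom⇒quasiProjective : ∀ S → (∀ g → IsHom S S g) → QuasiProjective S
isHom⇒quasiProjective S allHom _ f _ _ (_ , j-onto) =
  (λ v → proj₁ (j-onto (f v))) , allHom _ , λ v → proj₂ (j-onto (f v))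

PreservesEdges : FinHypergraph n → FinHypergraph m → (Fin n → Fin m) → Set
PreservesEdges H₁ H₂ g = ∀ {s} → Edge H₁ s → Edge H₂ (imageˢ g s)

isHom⇒preservesEdges : ∀ (H₁ : FinHypergraph n) (H₂ : FinHypergraph m) {g} →
  IsHom (toHypergraph H₁) (toHypergraph H₂) g → PreservesEdges H₁ H₂ g
isHom⇒preservesEdges H₁ H₂ {g} hom {s} e with hom (_∈ s) (s , e , λ _ → mk⇔ id id)
... | t , et , t≐ = subst (Edge H₂) (sym (imageˢ-unique g s t (⇔-sym ∘ t≐))) et

preservesEdges⇒isHom : ∀ (H₁ : FinHypergraph n) (H₂ : FinHypergraph m) {g} →
  PreservesEdges H₁ H₂ g → IsHom (toHypergraph H₁) (toHypergraph H₂) g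
preservesEdges⇒isHom H₁ H₂ {g} pres P (s , e , P≐s) =
  imageˢ g s , pres e ,
  λ w → ⇔-trans (image-resp-≐ g P≐s w) (⇔-sym (∈-imageˢ g s))

downClosed⇒preservesEdges : ∀ (H : FinHypergraph n) → DownClosed H → ∀ g → PreservesEdges H H g
downClosed⇒preservesEdges H dc g {s} e with Edge-nonempty H e
... | i , i∈s =
  dc ∣ s ∣ (x∈p⇒0<∣p∣ i∈s) (s , e , refl) (imageˢ g s)
     (g i , ∈-imageˢ⁺ g s (i , i∈s , refl)) (∣imageˢ∣≤∣s∣ g s)

preservesEdges⇒downClosed : ∀ (H : FinHypergraph n) → (∀ g → PreservesEdges H H g) → DownClosed H
preservesEdges⇒downClosed H pres k _ (s , e , ∣s∣≡k) t t-nonempty ∣t∣≤k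
  with map-onto s t t-nonempty (subst (∣ t ∣ ≤_) (sym ∣s∣≡k) ∣t∣≤k)
... | g , gs≡t = subst (Edge H) gs≡t (pres g e)

theorem5p2 : (n : ℕ) (H : FinHypergraph n) →
    (QuasiProjective (toHypergraph H) → DownClosed H) × (DownClosed H → QuasiProjective (toHypergraph H))
theorem5p2 n H =
  (λ qp → preservesEdges⇒downClosed H λ g →
     isHom⇒preservesEdges H H (quasiProjective⇒isHom S qp g)) ,
  (λ dc → isHom⇒quasiProjective S λ g →
     preservesEdges⇒isHom H H (downClosed⇒preservesEdges H dc g))
  where
  S = toHypergraph H
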